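{- Let $p$ be a prime, $q\in\mathbb{N}$ with $\gcd(p,q)=1$, $d\in\mathbb{N}$, and $G=C_p^d\times C_q$. Let $m=p(q+d-1)-(d-1)$, let $x_1\cdots x_m$ be a sequence over $C_p^d$ and $y_1\cdots y_m$ a sequence over $C_q$, and let $S=(x_1,y_1)\cdots(x_m,y_m)$. If there is $r\in[0,pq]$ such that $y_{r+1}=\cdots=y_m=0$, then $0_G\in[S]$, i.e. $S$ has a nonempty zero-sum subsequence.
   Context: Groups are finite abelian, written additively; $C_n$ is the cyclic group of order $n$; $[a,b]=\{x\in\mathbb{Z}:a\le x\le b\}$. A sequence is a finite list of group elements with repetition; subsequences are sub-multisets; a sequence is zero-sum if its terms sum to $0$. $[S]$ denotes the set of sums of nonempty subsequences of $S$. -}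

module Defs where

open import Data.Nat using (ℕ; zero; suc; _+_; _*_; _∸_)
open import Data.Nat.Divisibility using (_∣_)
open import Data.Fin using (Fin; toℕ)
open import Data.Bool using (Bool; true; false; if_then_else_)
open import Data.Product using (_×_; ∃)
open import Relation.Binary.PropositionalEquality using (_≡_)

-- The cyclic group C_n is modelled by Fin n (residues 0..n-1, addition mod n);
-- C_p^d is modelled by functions Fin d → Fin p (coordinatewise).
-- A subsequence of a sequence indexed by Fin m is a selection s : Fin m → Bool.

sumSel : ∀ {m} → (Fin m → Bool) → (Fin m → ℕ) → ℕ
sumSel {zero} s f = 0
sumSel {suc m} s f =
  (if s Fin.zero then f Fin.zero else 0) + sumSel (λ i → s (Fin.suc i)) (λ i → f (Fin.suc i))

HasNonemptyZeroSum : (p q d m : ℕ) → (Fin m → (Fin d → Fin p)) → (Fin m → Fin q) → Set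
HasNonemptyZeroSum p q d m x y =
  ∃ λ (s : Fin m → Bool) →
    (∃ λ i → s i ≡ true) ×
    ((j : Fin d) → p ∣ sumSel s (λ i → toℕ (x i j))) ×
    (q ∣ sumSel s (λ i → toℕ (y i)))

-- m = p(q+d-1) - (d-1), computed as p(q+d-1) + 1 - d (no truncation occurs
-- for p ≥ 2, q ≥ 1, which holds under the hypotheses)
mVal : ℕ → ℕ → ℕ → ℕ
mVal p q d = (p * (q + d ∸ 1) + 1) ∸ d

{-# OPTIONS --safe #-}

-- Let a = ⌊r/q⌋. The first a·q terms of S fall into a chunks of q consecutive terms, and by
-- pigeonhole on prefix sums each chunk contains a nonempty block whose C_q-components sum to 0.
-- Collapsing every block to its sum leaves, together with the at least m − r terms beyond
-- position r, at least a + m − r ≥ d(p − 1) + 1 terms of C_p^d × {0}; by Olson's theorem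
-- D(C_p^d) = d(p − 1) + 1 some nonempty subsequence of these sums to 0, and expanding the
-- collapsed blocks gives a zero-sum subsequence of S.
--
-- Olson's bound is proved by the polynomial method. As a function of a sublist T,
-- F(T) = ∏_j ∏_{k=1}^{p−1} (k − σ_j(T)), with σ_j the j-th coordinate sum, has degree d(p − 1),
-- so its alternating sum over the sublists of a longer sequence vanishes. If no nonempty
-- sublist were zero-sum, p would divide F(T) for every T ≠ [], hence also F([]) = ((p − 1)!)^d.

module Submission where

open import Defs
open import Data.Nat using (ℕ; _*_; _≤_)
open import Data.Nat.Primality using (Prime)
open import Data.Nat.Coprimality using (Coprime)
open import Data.Fin using (Fin; toℕ)
open import Data.Product using (∃; _×_)
open import Relation.Binary.PropositionalEquality using (_≡_)

open import Data.Bool using (Bool; true; false)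
open import Data.Empty using (⊥-elim)
open import Data.Fin using (zero; suc; fromℕ<)
open import Data.Fin.Properties using (all?; ¬∀⟶∃¬; toℕ<n; toℕ-fromℕ<; fromℕ<-injective; pigeonhole)
open import Data.Integer as ℤ using (ℤ; +_; 0ℤ; 1ℤ; -_; _-_)
open import Data.Integer.Divisibility.Signed
  using (divides; ∣ᵤ⇒∣; ∣⇒∣ᵤ; ∣m⇒∣m*n; ∣n⇒∣m*n; ∣m∣n⇒∣m-n; ∣m+n∣m⇒∣n; ∣m⇒∣-m)
  renaming (_∣_ to _∣ℤ_)
import Data.Integer.Properties as ℤ
open import Data.Integer.Tactic.RingSolver using (solve-∀)
open import Data.List using (List; []; _∷_; _++_; map; length; take; drop; filter; tabulate)
open import Data.List.Properties
  using ( map-++; ++-assoc; ++-conicalˡ; take-take; take++drop≡id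
        ; length-take; length-drop; length-tabulate; filter-accept; filter-all)
open import Data.List.Relation.Binary.Sublist.Propositional
  using (_⊆_; []; _∷_; _∷ʳ_; minimum; ⊆-trans)
open import Data.List.Relation.Binary.Sublist.Propositional.Properties
  using (take-⊆; drop-⊆; filter-⊆; filter⁺; drop⁺-≥; length-mono-≤; ++⁺; ++⁺ˡ; All-resp-⊆)
open import Data.List.Relation.Unary.All using (All; []; _∷_)
open import Data.List.Relation.Unary.All.Properties using (all-filter; tabulate⁺)
open import Data.Nat using (zero; suc; pred; _+_; _∸_; _⊓_; _<_; z≤n; s≤s; s≤s⁻¹; NonZero)
open import Data.Nat.Base using (nonTrivial⇒n>1)
import Data.Nat.Coprimality as Coprime
open import Data.Nat.Divisibility using (_∣_; divides; _∣?_; _∣0; ∣m∣n⇒∣m+n; >⇒∤; m%n≡0⇒n∣m)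
open import Data.Nat.DivMod using (_%_; _/_; m≡m%n+[m/n]*n; m%n<n; m/n*n≤m)
open import Data.Nat.ListAction using (sum)
open import Data.Nat.ListAction.Properties using (sum-++)
open import Data.Nat.Primality using (euclidsLemma; prime⇒nonZero; prime⇒nonTrivial)
import Data.Nat.Properties as ℕ
open import Algebra.Properties.CommutativeSemigroup ℕ.+-commutativeSemigroup using (x∙yz≈y∙xz)
import Data.Nat.Tactic.RingSolver as ℕ-Solver
open import Data.Product using (∃₂; _,_; proj₁; proj₂)
import Data.Product as Product
open import Data.Sum using (_⊎_; inj₁; inj₂)
import Data.Sum as Sum
open import Function using (_∘_; id)
open import Relation.Binary.PropositionalEquality
  using (refl; sym; trans; cong; cong₂; subst; _≗_; _≢_; module ≡-Reasoning)
open import Relation.Nullary using (¬_; Dec; yes; no; _×-dec_)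
open import Relation.Unary using (Decidable)

module _ {A : Set} where

  ≢[]? : (T : List A) → Dec (T ≢ [])
  ≢[]? []      = no λ []≢[] → []≢[] refl
  ≢[]? (_ ∷ _) = yes λ ()

  ++-split : ∀ X {Y T : List A} → T ⊆ X ++ Y →
             ∃₂ λ T₁ T₂ → T₁ ⊆ X × T₂ ⊆ Y × T ≡ T₁ ++ T₂
  ++-split []      T⊆Y           = [] , _ , [] , T⊆Y , refl
  ++-split (x ∷ X) (.x ∷ʳ T⊆XY)  with T₁ , T₂ , T₁⊆X , T₂⊆Y , refl ← ++-split X T⊆XY =
    T₁ , T₂ , x ∷ʳ T₁⊆X , T₂⊆Y , refl
  ++-split (x ∷ X) (refl ∷ T⊆XY) with T₁ , T₂ , T₁⊆X , T₂⊆Y , refl ← ++-split X T⊆XY =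
    x ∷ T₁ , T₂ , refl ∷ T₁⊆X , T₂⊆Y , refl

  any-sublist? : {P : List A → Set} → Decidable P → ∀ V → Dec (∃ λ T → T ⊆ V × P T)
  any-sublist? P? [] with P? []
  ... | yes P[] = yes ([] , [] , P[])
  ... | no ¬P[] = no λ { (.[] , [] , P[]) → ¬P[] P[] }
  any-sublist? P? (v ∷ V) with any-sublist? P? V | any-sublist? (λ T → P? (v ∷ T)) V
  ... | yes (T , T⊆V , PT) | _                    = yes (T , v ∷ʳ T⊆V , PT)
  ... | no _               | yes (T , T⊆V , PvT) = yes (v ∷ T , refl ∷ T⊆V , PvT)
  ... | no ¬skip           | no ¬keep             = no λ
    { (T , v ∷ʳ T⊆V , PT)          → ¬skip (T , T⊆V , PT)
    ; (v ∷ T , refl ∷ T⊆V , PvT) → ¬keep (T , T⊆V , PvT)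
    }

total : {A : Set} → (A → ℕ) → List A → ℕ
total w T = sum (map w T)

module _ {A : Set} (w : A → ℕ) where

  total-++ : ∀ X Y → total w (X ++ Y) ≡ total w X + total w Y
  total-++ X Y = trans (cong sum (map-++ w X Y)) (sum-++ (map w X) (map w Y))

  total-move : ∀ {b} B T₁ T₂ → w b ≡ total w B → total w (B ++ T₁ ++ T₂) ≡ total w (T₁ ++ b ∷ T₂)
  total-move {b} B T₁ T₂ wb≡ = begin
    total w (B ++ T₁ ++ T₂)                ≡⟨ total-++ B (T₁ ++ T₂) ⟩
    total w B + total w (T₁ ++ T₂)         ≡⟨ cong (_+_ (total w B)) (total-++ T₁ T₂) ⟩
    total w B + (total w T₁ + total w T₂)  ≡⟨ x∙yz≈y∙xz (total w B) (total w T₁) (total w T₂) ⟩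
    total w T₁ + (total w B + total w T₂)  ≡⟨ cong (λ s → total w T₁ + (s + total w T₂)) wb≡ ⟨
    total w T₁ + total w (b ∷ T₂)          ≡⟨ total-++ T₁ (b ∷ T₂) ⟨
    total w (T₁ ++ b ∷ T₂)                 ∎
    where open ≡-Reasoning

  total-take : ∀ {i j} C → i ≤ j →
               total w (take j C) ≡ total w (take i C) + total w (drop i (take j C))
  total-take {i} {j} C i≤j = begin
    total w (take j C)                ≡⟨ cong (total w) (take++drop≡id i (take j C)) ⟨
    total w (take i (take j C) ++ D)  ≡⟨ total-++ (take i (take j C)) D ⟩
    total w (take i (take j C)) + D′  ≡⟨ cong (λ X → total w X + D′) (take-take i j C) ⟩
    total w (take (i ⊓ j) C) + D′     ≡⟨ cong (λ k → total w (take k C) + D′) (ℕ.m≤n⇒m⊓n≡m i≤j) ⟩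
    total w (take i C) + D′           ∎
    where
    open ≡-Reasoning
    D = drop i (take j C)
    D′ = total w D

  ∣-total : ∀ {k T} → All (λ a → k ∣ w a) T → k ∣ total w T
  ∣-total {k} []           = k ∣0
  ∣-total     (k∣a ∷ k∣as) = ∣m∣n⇒∣m+n k∣a (∣-total k∣as)

∏ : ∀ n → (Fin n → ℤ) → ℤ
∏ zero    h = 1ℤ
∏ (suc n) h = h zero ℤ.* ∏ n (h ∘ suc)

∣-∏ : ∀ {k n} (h : Fin n → ℤ) i → k ∣ℤ h i → k ∣ℤ ∏ n h
∣-∏ h zero    k∣hi = ∣m⇒∣m*n _ k∣hi
∣-∏ h (suc i) k∣hi = ∣n⇒∣m*n (h zero) (∣-∏ (h ∘ suc) i k∣hi)

module _ {p} (p-prime : Prime p) where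

  euclidsLemmaℤ : ∀ a b → + p ∣ℤ a ℤ.* b → + p ∣ℤ a ⊎ + p ∣ℤ b
  euclidsLemmaℤ a b p∣ab = Sum.map ∣ᵤ⇒∣ ∣ᵤ⇒∣
    (euclidsLemma ℤ.∣ a ∣ ℤ.∣ b ∣ p-prime (subst (p ∣_) (ℤ.abs-* a b) (∣⇒∣ᵤ p∣ab)))

  prime∤∏ : ∀ {n} (h : Fin n → ℤ) → (∀ i → ¬ + p ∣ℤ h i) → ¬ + p ∣ℤ ∏ n h
  prime∤∏ {zero}  h p∤h p∣1 = >⇒∤ (nonTrivial⇒n>1 p {{prime⇒nonTrivial p-prime}}) (∣⇒∣ᵤ p∣1)
  prime∤∏ {suc n} h p∤h p∣∏ with euclidsLemmaℤ (h zero) (∏ n (h ∘ suc)) p∣∏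
  ... | inj₁ p∣h₀ = p∤h zero p∣h₀
  ... | inj₂ p∣∏′ = prime∤∏ (h ∘ suc) (p∤h ∘ suc) p∣∏′

module FiniteDifferences {A : Set} where

  Δ : A → (List A → ℤ) → List A → ℤ
  Δ v g T = g (v ∷ T) - g T

  DegreeBelow : ℕ → (List A → ℤ) → Set
  DegreeBelow zero    g = ∀ T → g T ≡ 0ℤ
  DegreeBelow (suc n) g = ∀ v → DegreeBelow n (Δ v g)

  DegreeBelow-resp : ∀ n {f g} → f ≗ g → DegreeBelow n f → DegreeBelow n g
  DegreeBelow-resp zero    f≗g df T = trans (sym (f≗g T)) (df T)
  DegreeBelow-resp (suc n) f≗g df v =
    DegreeBelow-resp n (λ T → cong₂ _-_ (f≗g (v ∷ T)) (f≗g T)) (df v)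

  vanishing⇒DegreeBelow : ∀ n {g} → DegreeBelow 0 g → DegreeBelow n g
  vanishing⇒DegreeBelow zero    g≗0 = g≗0
  vanishing⇒DegreeBelow (suc n) g≗0 v =
    vanishing⇒DegreeBelow n λ T → cong₂ _-_ (g≗0 (v ∷ T)) (g≗0 T)

  DegreeBelow-suc : ∀ n {g} → DegreeBelow n g → DegreeBelow (suc n) g
  DegreeBelow-suc zero    dg   = vanishing⇒DegreeBelow 1 dg
  DegreeBelow-suc (suc n) dg v = DegreeBelow-suc n (dg v)

  DegreeBelow-const : ∀ c → DegreeBelow 1 (λ _ → c)
  DegreeBelow-const c v T = ℤ.+-inverseʳ c

  DegreeBelow-+ : ∀ n {f g} → DegreeBelow n f → DegreeBelow n g →
                  DegreeBelow n (λ T → f T ℤ.+ g T)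
  DegreeBelow-+ zero    df dg T = cong₂ ℤ._+_ (df T) (dg T)
  DegreeBelow-+ (suc n) {f} {g} df dg v =
    DegreeBelow-resp n (λ T → Δ-+ (f (v ∷ T)) (g (v ∷ T)) (f T) (g T))
      (DegreeBelow-+ n (df v) (dg v))
    where
    Δ-+ : ∀ a b c e → (a - c) ℤ.+ (b - e) ≡ (a ℤ.+ b) - (c ℤ.+ e)
    Δ-+ = solve-∀

  DegreeBelow-shift : ∀ n v {g} → DegreeBelow n g → DegreeBelow n (λ T → g (v ∷ T))
  DegreeBelow-shift n v {g} dg =
    DegreeBelow-resp n (λ T → shift (g T) (g (v ∷ T)))
      (DegreeBelow-+ n dg (DegreeBelow-suc n dg v))
    where
    shift : ∀ a b → a ℤ.+ (b - a) ≡ b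
    shift = solve-∀

  DegreeBelow-* : ∀ m n {f g} → DegreeBelow (suc m) f → DegreeBelow (suc n) g →
                  DegreeBelow (suc (m + n)) (λ T → f T ℤ.* g T)
  DegreeBelow-* m n {f} {g} df dg v =
    DegreeBelow-resp (m + n) (λ T → product-rule (f (v ∷ T)) (g (v ∷ T)) (f T) (g T))
      (DegreeBelow-+ (m + n) (left m df) (right n dg))
    where
    product-rule : ∀ a b c e → (a - c) ℤ.* b ℤ.+ c ℤ.* (b - e) ≡ a ℤ.* b - c ℤ.* e
    product-rule = solve-∀
    left : ∀ m → DegreeBelow (suc m) f → DegreeBelow (m + n) (λ T → Δ v f T ℤ.* g (v ∷ T))
    left zero    df = vanishing⇒DegreeBelow n λ T → cong (ℤ._* g (v ∷ T)) (df v T)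
    left (suc m) df = DegreeBelow-* m n {Δ v f} (df v) (DegreeBelow-shift (suc n) v {g} dg)
    right : ∀ n → DegreeBelow (suc n) g → DegreeBelow (m + n) (λ T → f T ℤ.* Δ v g T)
    right zero    dg = vanishing⇒DegreeBelow (m + 0) λ T →
      trans (cong (f T ℤ.*_) (dg v T)) (ℤ.*-zeroʳ (f T))
    right (suc n) dg rewrite ℕ.+-suc m n = DegreeBelow-* m n {f} {Δ v g} df (dg v)

  DegreeBelow-∏ : ∀ n D {h : Fin n → List A → ℤ} → (∀ i → DegreeBelow (suc D) (h i)) →
                  DegreeBelow (suc (n * D)) (λ T → ∏ n λ i → h i T)
  DegreeBelow-∏ zero    D    dh = DegreeBelow-const 1ℤ
  DegreeBelow-∏ (suc n) D {h} dh =
    DegreeBelow-* D (n * D) {h zero} {λ T → ∏ n λ i → h (suc i) T}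
      (dh zero) (DegreeBelow-∏ n D (dh ∘ suc))

  DegreeBelow-affine : ∀ c (w : A → ℕ) → DegreeBelow 2 (λ T → c - + total w T)
  DegreeBelow-affine c w v = DegreeBelow-resp 1 (sym ∘ slope) (DegreeBelow-const (- + w v))
    where
    cancel : ∀ c a b → (c - (a ℤ.+ b)) - (c - b) ≡ - a
    cancel = solve-∀
    slope : ∀ T → Δ v (λ T → c - + total w T) T ≡ - + w v
    slope T = trans (cong (λ s → (c - s) - (c - + total w T)) (ℤ.pos-+ (w v) (total w T)))
                    (cancel c (+ w v) (+ total w T))

  -- Δ* V g = Σ_{T ⊆ V} (−1)^(|V| − |T|) g T
  Δ* : List A → (List A → ℤ) → ℤ
  Δ* []      g = g []
  Δ* (v ∷ V) g = Δ* V (Δ v g)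

  Δ*-vanishes : ∀ V n {g} → n ≤ length V → DegreeBelow n g → Δ* V g ≡ 0ℤ
  Δ*-vanishes []      zero    z≤n       dg = dg []
  Δ*-vanishes (v ∷ V) zero    z≤n       dg = Δ*-vanishes V zero z≤n (DegreeBelow-suc 0 dg v)
  Δ*-vanishes (v ∷ V) (suc n) (s≤s n≤V) dg = Δ*-vanishes V n n≤V (dg v)

  Δ*-∣ : ∀ {k} V {g} → (∀ {T} → T ⊆ V → T ≢ [] → k ∣ℤ g T) → k ∣ℤ Δ* V g → k ∣ℤ g []
  Δ*-∣ []      k∣g k∣Δ* = k∣Δ*
  Δ*-∣ (v ∷ V) {g} k∣g k∣Δ* =
    subst (_ ∣ℤ_) (ℤ.neg-involutive (g [])) (∣m⇒∣-m (∣m+n∣m⇒∣n k∣Δvg k∣g[v]))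
    where
    k∣Δvg : _ ∣ℤ Δ v g []
    k∣Δvg = Δ*-∣ V (λ T⊆V T≢[] → ∣m∣n⇒∣m-n (k∣g (refl ∷ T⊆V) λ ()) (k∣g (v ∷ʳ T⊆V) T≢[])) k∣Δ*
    k∣g[v] : _ ∣ℤ g (v ∷ [])
    k∣g[v] = k∣g (refl ∷ minimum V) λ ()

module Olson {p} (p-prime : Prime p) {A : Set} {d} (f : A → Fin d → ℕ) where

  open FiniteDifferences {A}

  private instance
    p≢0 : NonZero p
    p≢0 = prime⇒nonZero p-prime

  coordinate : Fin d → List A → ℕ
  coordinate j = total λ a → f a j

  zeroTest : ℕ → ℤ
  zeroTest a = ∏ (pred p) λ i → + suc (toℕ i) - + a

  p∤zeroTest[0] : ¬ + p ∣ℤ zeroTest 0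
  p∤zeroTest[0] = prime∤∏ p-prime {pred p} (λ i → + suc (toℕ i) - + 0) λ i →
    subst (λ z → ¬ + p ∣ℤ z) (sym (ℤ.+-identityʳ _))
      (p∤small (toℕ i) (ℕ.m≤pred[n]⇒suc[m]≤n (toℕ<n i)))
    where
    p∤small : ∀ n → suc n < p → ¬ + p ∣ℤ + suc n
    p∤small n n<p p∣n = >⇒∤ n<p (∣⇒∣ᵤ p∣n)

  p∣[a%p]-a : ∀ a → + p ∣ℤ + (a % p) - + a
  p∣[a%p]-a a = divides (- + (a / p)) (begin
    + (a % p) - + a                                ≡⟨ cong (_-_ (+ (a % p))) a≡ ⟩
    + (a % p) - (+ (a % p) ℤ.+ + (a / p) ℤ.* + p)  ≡⟨ cancel (+ (a % p)) (+ (a / p)) (+ p) ⟩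
    - + (a / p) ℤ.* + p                            ∎)
    where
    open ≡-Reasoning
    a≡ : + a ≡ + (a % p) ℤ.+ + (a / p) ℤ.* + p
    a≡ = trans (cong +_ (m≡m%n+[m/n]*n a p))
           (trans (ℤ.pos-+ (a % p) (a / p * p)) (cong (ℤ._+_ (+ (a % p))) (ℤ.pos-* (a / p) p)))
    cancel : ∀ r s q → r - (r ℤ.+ s ℤ.* q) ≡ - s ℤ.* q
    cancel = solve-∀

  p∣zeroTest : ∀ a → ¬ p ∣ a → + p ∣ℤ zeroTest a
  p∣zeroTest a p∤a with a % p in a%p≡ | m%n<n a p | p∣[a%p]-a a
  ... | zero  | _   | _  = ⊥-elim (p∤a (m%n≡0⇒n∣m a p a%p≡))
  ... | suc t | t<p | p∣ = ∣-∏ _ (fromℕ< (ℕ.suc[m]≤n⇒m≤pred[n] t<p))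
    (subst (λ k → + p ∣ℤ + suc k - + a) (sym (toℕ-fromℕ< _)) p∣)

  olson : ∀ V → d * pred p < length V → ∃ λ T → T ⊆ V × T ≢ [] × ∀ j → p ∣ coordinate j T
  olson V long with any-sublist? (λ T → ≢[]? T ×-dec all? λ j → p ∣? coordinate j T) V
  ... | yes found = found
  ... | no none = ⊥-elim (prime∤∏ p-prime {d} (λ _ → zeroTest 0) (λ _ → p∤zeroTest[0]) p∣F[])
    where
    F : List A → ℤ
    F T = ∏ d λ j → zeroTest (coordinate j T)
    F-degree : DegreeBelow (suc (d * (pred p * 1))) F
    F-degree = DegreeBelow-∏ d (pred p * 1) λ j →
      DegreeBelow-∏ (pred p) 1 λ i → DegreeBelow-affine (+ suc (toℕ i)) (λ a → f a j)
    long′ : suc (d * (pred p * 1)) ≤ length V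
    long′ = subst (λ k → suc (d * k) ≤ length V) (sym (ℕ.*-identityʳ (pred p))) long
    p∣F : ∀ {T} → T ⊆ V → T ≢ [] → + p ∣ℤ F T
    p∣F {T} T⊆V T≢[]
      with j , p∤ ← ¬∀⟶∃¬ d _ (λ j → p ∣? coordinate j T) (λ p∣ → none (T , T⊆V , T≢[] , p∣)) =
      ∣-∏ _ j (p∣zeroTest (coordinate j T) p∤)
    p∣F[] : + p ∣ℤ F []
    p∣F[] = Δ*-∣ V p∣F (subst (+ p ∣ℤ_) (sym (Δ*-vanishes V _ long′ F-degree)) (divides 0ℤ refl))

module _ {q} .{{_ : NonZero q}} where

  [m+n]%q≡m%q⇒q∣n : ∀ m n → (m + n) % q ≡ m % q → q ∣ n
  [m+n]%q≡m%q⇒q∣n m n eq = divides ((m + n) / q ∸ m / q) (begin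
    n
      ≡⟨ ℕ.m+n∸m≡n m n ⟨
    (m + n) ∸ m
      ≡⟨ cong₂ _∸_ (m≡m%n+[m/n]*n (m + n) q) (m≡m%n+[m/n]*n m q) ⟩
    ((m + n) % q + (m + n) / q * q) ∸ (m % q + m / q * q)
      ≡⟨ cong (λ r → (r + (m + n) / q * q) ∸ (m % q + m / q * q)) eq ⟩
    (m % q + (m + n) / q * q) ∸ (m % q + m / q * q)
      ≡⟨ ℕ.[m+n]∸[m+o]≡n∸o (m % q) _ _ ⟩
    (m + n) / q * q ∸ m / q * q
      ≡⟨ ℕ.*-distribʳ-∸ q ((m + n) / q) (m / q) ⟨
    ((m + n) / q ∸ m / q) * q
      ∎)
    where open ≡-Reasoning

  segment≢[] : {A : Set} → ∀ i j (C : List A) → i < j → j ≤ length C → drop i (take j C) ≢ []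
  segment≢[] zero    (suc j) (c ∷ C) _         _         ()
  segment≢[] (suc i) (suc j) (c ∷ C) (s≤s i<j) (s≤s j≤C) = segment≢[] i j C i<j j≤C

  residue : ℕ → Fin q
  residue n = fromℕ< (m%n<n n q)

  cyclic-zeroSum : {A : Set} (w : A → ℕ) → ∀ C → q ≤ length C →
                   ∃ λ B → B ⊆ C × B ≢ [] × q ∣ total w B
  cyclic-zeroSum w C q≤C
    with i , j , i<j , same ← pigeonhole (ℕ.n<1+n q) (λ k → residue (total w (take (toℕ k) C))) =
    drop (toℕ i) (take (toℕ j) C) ,
    ⊆-trans (drop-⊆ (toℕ i) _) (take-⊆ (toℕ j) C) ,
    segment≢[] (toℕ i) (toℕ j) C i<j (ℕ.≤-trans (s≤s⁻¹ (toℕ<n j)) q≤C) ,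
    [m+n]%q≡m%q⇒q∣n _ _ (trans (cong (_% q) (sym (total-take w C (ℕ.<⇒≤ i<j))))
                               (sym (fromℕ<-injective _ _ _ _ same)))

module _ {A : Set} {P : A → Set} (P? : Decidable P) where

  All-drop-tabulate : ∀ {n} r (g : Fin n → A) → (∀ i → r ≤ toℕ i → P (g i)) →
                      All P (drop r (tabulate g))
  All-drop-tabulate         zero    g Pg = tabulate⁺ λ i → Pg i z≤n
  All-drop-tabulate {zero}  (suc r) g Pg = []
  All-drop-tabulate {suc n} (suc r) g Pg =
    All-drop-tabulate r (g ∘ suc) λ i r≤i → Pg (suc i) (s≤s r≤i)

  length-filter-drop-tabulate : ∀ {n k r} (g : Fin n → A) → k ≤ r → (∀ i → r ≤ toℕ i → P (g i)) →
                                n ∸ r ≤ length (filter P? (drop k (tabulate g)))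
  length-filter-drop-tabulate {n} {k} {r} g k≤r Pg = begin
    n ∸ r                                     ≡⟨ cong (_∸ r) (length-tabulate g) ⟨
    length (tabulate g) ∸ r                   ≡⟨ length-drop r (tabulate g) ⟨
    length (drop r (tabulate g))
      ≡⟨ cong length (filter-all P? (All-drop-tabulate r g Pg)) ⟨
    length (filter P? (drop r (tabulate g)))
      ≤⟨ length-mono-≤ (filter⁺ P? P? (λ { refl Pa → Pa }) (drop⁺-≥ k≤r)) ⟩
    length (filter P? (drop k (tabulate g)))
      ∎
    where open ℕ.≤-Reasoning

toSelection : {A : Set} {n : ℕ} (g : Fin n → A) {T : List A} → T ⊆ tabulate g →
              ∃ λ (s : Fin n → Bool) → (T ≢ [] → ∃ λ i → s i ≡ true) ×
                                       (∀ w → sumSel s (λ i → w (g i)) ≡ total w T)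
toSelection {n = zero}  g []          = (λ ()) , (λ T≢[] → ⊥-elim (T≢[] refl)) , λ _ → refl
toSelection {n = suc n} g (_ ∷ʳ T⊆)   with s , hit , sums ← toSelection (g ∘ suc) T⊆ =
  (λ { zero → false ; (suc i) → s i }) , Product.map suc id ∘ hit , sums
toSelection {n = suc n} g (refl ∷ T⊆) with s , hit , sums ← toSelection (g ∘ suc) T⊆ =
  (λ { zero → true ; (suc i) → s i }) , (λ _ → zero , refl) , λ w → cong (_+_ (w (g zero))) (sums w)

module ProductGroup {p q d : ℕ} (p-prime : Prime p) .{{_ : NonZero q}} where

  Element : Set
  Element = (Fin d → ℕ) × ℕ

  open Olson p-prime {Element} proj₁ using (coordinate; olson)

  ZeroSum : List Element → Set
  ZeroSum T = T ≢ [] × (∀ j → p ∣ coordinate j T) × q ∣ total proj₂ T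

  HasZeroSum : List Element → Set
  HasZeroSum L = ∃ λ T → T ⊆ L × ZeroSum T

  YZero : Element → Set
  YZero e = q ∣ proj₂ e

  yZero? : Decidable YZero
  yZero? e = q ∣? proj₂ e

  collapse : List Element → Element
  collapse B = (λ j → coordinate j B) , total proj₂ B

  contract : ∀ {B C} P R → B ⊆ C → B ≢ [] →
             HasZeroSum (P ++ collapse B ∷ R) → HasZeroSum (C ++ P ++ R)
  contract {B} {C} P R B⊆C B≢[] (T , T⊆ , T≢[] , p∣ , q∣) with ++-split P T⊆
  ... | T₁ , T₂ , T₁⊆P , _ ∷ʳ T₂⊆R , refl = T₁ ++ T₂ , ++⁺ˡ C (++⁺ T₁⊆P T₂⊆R) , T≢[] , p∣ , q∣
  ... | T₁ , _ ∷ T₂ , T₁⊆P , refl ∷ T₂⊆R , refl =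
    B ++ T₁ ++ T₂ , ++⁺ B⊆C (++⁺ T₁⊆P T₂⊆R) , B≢[] ∘ ++-conicalˡ B (T₁ ++ T₂) ,
    (λ j → subst (p ∣_) (sym (total-move (λ e → proj₁ e j) B T₁ T₂ refl)) (p∣ j)) ,
    subst (q ∣_) (sym (total-move proj₂ B T₁ T₂ refl)) q∣

  HasZeroSum-chunks : ∀ a P R → length P ≡ a * q →
                      suc (d * pred p) ≤ a + length (filter yZero? R) → HasZeroSum (P ++ R)
  HasZeroSum-chunks zero [] R _ enough with T , T⊆ , T≢[] , p∣ ← olson (filter yZero? R) enough =
    T , ⊆-trans T⊆ (filter-⊆ yZero? R) , T≢[] , p∣ ,
    ∣-total proj₂ (All-resp-⊆ T⊆ (all-filter yZero? R))
  HasZeroSum-chunks (suc a) P R |P|≡ enough = absorb (cyclic-zeroSum proj₂ C |C|≥q)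
    where
    C = take q P
    P′ = drop q P
    |C|≥q : q ≤ length C
    |C|≥q = ℕ.≤-reflexive (sym (trans (length-take q P)
              (ℕ.m≤n⇒m⊓n≡m (subst (q ≤_) (sym |P|≡) (ℕ.m≤m+n q (a * q))))))
    |P′|≡ : length P′ ≡ a * q
    |P′|≡ = trans (length-drop q P) (trans (cong (_∸ q) |P|≡) (ℕ.m+n∸m≡n q (a * q)))
    C++P′≡P : C ++ P′ ++ R ≡ P ++ R
    C++P′≡P = trans (sym (++-assoc C P′ R)) (cong (_++ R) (take++drop≡id q P))
    absorb : (∃ λ B → B ⊆ C × B ≢ [] × q ∣ total proj₂ B) → HasZeroSum (P ++ R)
    absorb (B , B⊆C , B≢[] , q∣B) =
      subst HasZeroSum C++P′≡P
        (contract P′ R B⊆C B≢[] (HasZeroSum-chunks a P′ (collapse B ∷ R) |P′|≡ enough′))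
      where
      enough′ : suc (d * pred p) ≤ a + length (filter yZero? (collapse B ∷ R))
      enough′ rewrite filter-accept yZero? {collapse B} {R} q∣B
                    | ℕ.+-suc a (length (filter yZero? R)) = enough

  HasZeroSum-tabulate : ∀ {n} (g : Fin n → Element) r → r ≤ n → (∀ i → r ≤ toℕ i → YZero (g i)) →
                        suc (d * pred p) ≤ r / q + (n ∸ r) → HasZeroSum (tabulate g)
  HasZeroSum-tabulate g r r≤n tail-yZero enough =
    subst HasZeroSum (take++drop≡id k L)
      (HasZeroSum-chunks a (take k L) (drop k L) |P|≡
        (ℕ.≤-trans enough (ℕ.+-monoʳ-≤ a (length-filter-drop-tabulate yZero? g k≤r tail-yZero))))
    where
    L = tabulate g
    a = r / q
    k = a * q
    k≤r : k ≤ r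
    k≤r = m/n*n≤m r q
    |P|≡ : length (take k L) ≡ k
    |P|≡ = trans (length-take k L)
             (trans (cong (k ⊓_) (length-tabulate g)) (ℕ.m≤n⇒m⊓n≡m (ℕ.≤-trans k≤r r≤n)))

  HasZeroSum⇒HasNonemptyZeroSum : ∀ {m} (x : Fin m → Fin d → Fin p) (y : Fin m → Fin q) →
    HasZeroSum (tabulate λ i → (λ j → toℕ (x i j)) , toℕ (y i)) → HasNonemptyZeroSum p q d m x y
  HasZeroSum⇒HasNonemptyZeroSum x y (T , T⊆ , T≢[] , p∣ , q∣)
    with s , hit , sums ← toSelection _ T⊆ =
    s , hit T≢[] ,
    (λ j → subst (p ∣_) (sym (sums λ e → proj₁ e j)) (p∣ j)) ,
    subst (q ∣_) (sym (sums proj₂)) q∣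

mVal≡ : ∀ p₁ q₁ d → mVal (suc p₁) (suc q₁) d ≡ suc p₁ * q₁ + suc (d * p₁)
mVal≡ p₁ q₁ d = begin
  (suc p₁ * (q₁ + d) + 1) ∸ d           ≡⟨ cong (_∸ d) (expand p₁ q₁ d) ⟩
  (suc p₁ * q₁ + suc (d * p₁)) + d ∸ d  ≡⟨ ℕ.m+n∸n≡m _ d ⟩
  suc p₁ * q₁ + suc (d * p₁)            ∎
  where
  open ≡-Reasoning
  expand : ∀ p₁ q₁ d → suc p₁ * (q₁ + d) + 1 ≡ (suc p₁ * q₁ + suc (d * p₁)) + d
  expand = ℕ-Solver.solve-∀

quotient-bound : ∀ p₁ q₁ r → r ≤ suc p₁ * suc q₁ → r ≤ r / suc q₁ + suc p₁ * q₁
quotient-bound p₁ q₁ r r≤pq with r / suc q₁ ℕ.<? suc p₁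
... | yes a<p = begin
  r                          ≡⟨ m≡m%n+[m/n]*n r (suc q₁) ⟩
  r % suc q₁ + a * suc q₁    ≤⟨ ℕ.+-monoˡ-≤ (a * suc q₁) (s≤s⁻¹ (m%n<n r (suc q₁))) ⟩
  q₁ + a * suc q₁            ≡⟨ regroup a q₁ ⟩
  a + suc a * q₁             ≤⟨ ℕ.+-monoʳ-≤ a (ℕ.*-monoˡ-≤ q₁ a<p) ⟩
  a + suc p₁ * q₁            ∎
  where
  open ℕ.≤-Reasoning
  a = r / suc q₁
  regroup : ∀ a q₁ → q₁ + a * suc q₁ ≡ a + suc a * q₁
  regroup = ℕ-Solver.solve-∀
... | no a≮p = begin
  r                          ≤⟨ r≤pq ⟩
  suc p₁ * suc q₁            ≡⟨ ℕ.*-suc (suc p₁) q₁ ⟩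
  suc p₁ + suc p₁ * q₁       ≤⟨ ℕ.+-monoˡ-≤ (suc p₁ * q₁) (ℕ.≮⇒≥ a≮p) ⟩
  r / suc q₁ + suc p₁ * q₁   ∎
  where open ℕ.≤-Reasoning

≤-+-∸ : ∀ a b c r → r ≤ a + b → c ≤ a + ((b + c) ∸ r)
≤-+-∸ a b c r r≤a+b = begin
  c                        ≤⟨ ℕ.m≤n+m∸n c a ⟩
  a + (c ∸ a)              ≡⟨ cong (_+_ a) (ℕ.[m+n]∸[m+o]≡n∸o b c a) ⟨
  a + ((b + c) ∸ (b + a))  ≤⟨ ℕ.+-monoʳ-≤ a (ℕ.∸-monoʳ-≤ (b + c) r≤b+a) ⟩
  a + ((b + c) ∸ r)        ∎
  where
  open ℕ.≤-Reasoning
  r≤b+a : r ≤ b + a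
  r≤b+a = subst (r ≤_) (ℕ.+-comm a b) r≤a+b

enough-terms : ∀ {p q} .{{_ : NonZero p}} .{{_ : NonZero q}} d r → r ≤ p * q →
               suc (d * pred p) ≤ r / q + (mVal p q d ∸ r)
enough-terms {suc p₁} {suc q₁} d r r≤pq rewrite mVal≡ p₁ q₁ d =
  ≤-+-∸ (r / suc q₁) (suc p₁ * q₁) (suc (d * p₁)) r (quotient-bound p₁ q₁ r r≤pq)

coprime⇒nonZero : ∀ {p q} → Prime p → Coprime p q → NonZero q
coprime⇒nonZero {q = zero}  p-prime coprime =
  ⊥-elim (Coprime.¬0-coprimeTo-2+ {{prime⇒nonTrivial p-prime}} (Coprime.sym coprime))
coprime⇒nonZero {q = suc _} _       _       = _

≤-⊓-index : ∀ {n} r (i : Fin n) → r ⊓ n ≤ toℕ i → r ≤ toℕ i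
≤-⊓-index {n} r i r⊓n≤i with ℕ.≤-total r n
... | inj₁ r≤n = subst (_≤ toℕ i) (ℕ.m≤n⇒m⊓n≡m r≤n) r⊓n≤i
... | inj₂ n≤r = ⊥-elim (ℕ.<⇒≱ (toℕ<n i) (subst (_≤ toℕ i) (ℕ.m≥n⇒m⊓n≡n n≤r) r⊓n≤i))

proposition14 : (p q d : ℕ) → Prime p → Coprime p q →
    (x : Fin (mVal p q d) → (Fin d → Fin p)) →
    (y : Fin (mVal p q d) → Fin q) →
    (∃ λ r → r ≤ p * q × ((i : Fin (mVal p q d)) → r ≤ toℕ i → toℕ (y i) ≡ 0)) →
    HasNonemptyZeroSum p q d (mVal p q d) x y
proposition14 p q d p-prime coprime x y (r , r≤pq , y≡0) =
  HasZeroSum⇒HasNonemptyZeroSum x y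
    (HasZeroSum-tabulate _ r′ (ℕ.m⊓n≤n r m) tail-yZero
      (enough-terms {p} {q} d r′ (ℕ.≤-trans (ℕ.m⊓n≤m r m) r≤pq)))
  where
  instance
    p≢0 : NonZero p
    p≢0 = prime⇒nonZero p-prime
    q≢0 : NonZero q
    q≢0 = coprime⇒nonZero p-prime coprime
  open ProductGroup {p} {q} {d} p-prime
  m = mVal p q d
  r′ = r ⊓ m
  tail-yZero : ∀ i → r′ ≤ toℕ i → q ∣ toℕ (y i)
  tail-yZero i r′≤i = subst (q ∣_) (sym (y≡0 i (≤-⊓-index r i r′≤i))) (q ∣0)
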